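{- Let $T$ be a $\{1,3\}$-tree, let $X_T$ be its set of leaf-edges, and let $X\subseteq X_T$ with $|X|$ even. Then there exists a unique point $x\in\mathcal{P}_T$ such that $x_e=\frac12$ for $e\in X$ and $x_e=0$ for $e\in X_T\setminus X$. Moreover, all coordinates of $x$ are in $\{0,\frac12\}$ and its support is the edge set of a collection of pairwise vertex-disjoint leaf-paths of $T$.
   Context: A $\{1,3\}$-tree is a finite tree all of whose nodes have degree $1$ (leaves) or $3$ (internal nodes). A leaf-edge is an edge incident with a leaf. A leaf-path is a path in $T$ whose two extreme edges are leaf-edges (a single edge joining two leaves is a leaf-path). With $E$ the edge set, $\mathcal{P}_T\subset\mathbb{R}^E$ is the set of $w$ such that for every internal node $v$ with incident edges $a,b,c$: $w_a\le w_b+w_c$, $w_b\le w_a+w_c$, $w_c\le w_a+w_b$, $w_a+w_b+w_c\le1$; and if $T$ consists of a single edge $e$, $\mathcal{P}_T=\{w: 0\le w_e\le\frac12\}$. -}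

module Defs where

open import Data.Nat using (ℕ; zero; suc; _≤_)
open import Data.Nat.Divisibility using (_∣_)
open import Data.Fin using (Fin; _≟_)
open import Data.Fin.Subset using (Subset; _∈_; _∉_; ∣_∣)
open import Data.List using (List; []; _∷_; length; filter; allFin)
open import Data.List.Membership.Propositional renaming (_∈_ to _∈ₗ_)
open import Data.List.Relation.Unary.Any using (Any)
open import Data.List.Relation.Unary.AllPairs using (AllPairs)
open import Data.List.Relation.Unary.Unique.Propositional using (Unique)
open import Data.List.Relation.Binary.Disjoint.Propositional using (Disjoint)
open import Data.Product using (Σ; _×_; _,_; proj₁; proj₂; ∃)
open import Data.Sum using (_⊎_)
open import Relation.Nullary using (¬_)
open import Relation.Nullary.Decidable using (_⊎-dec_)
open import Relation.Binary.PropositionalEquality using (_≡_; _≢_)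
open import Data.Rational using (ℚ; 0ℚ; 1ℚ; ½; _+_) renaming (_≤_ to _≤ℚ_)

record Graph (n m : ℕ) : Set where
  field
    src : Fin m → Fin n
    tgt : Fin m → Fin n

module _ {n m : ℕ} (G : Graph n m) where
  open Graph G

  Joins : Fin m → Fin n → Fin n → Set
  Joins e u w = (src e ≡ u × tgt e ≡ w) ⊎ (src e ≡ w × tgt e ≡ u)

  deg : Fin n → ℕ
  deg v = length (filter (λ e → (src e ≟ v) ⊎-dec (tgt e ≟ v)) (allFin m))

  data Walk : Fin n → Fin n → Set where
    [] : ∀ {u} → Walk u u
    step : ∀ {u w v} (e : Fin m) → Joins e u w → Walk w v → Walk u v

  walkVertices : ∀ {u v} → Walk u v → List (Fin n)
  walkVertices {u} [] = u ∷ []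
  walkVertices {u} (step e _ p) = u ∷ walkVertices p

  walkEdges : ∀ {u v} → Walk u v → List (Fin m)
  walkEdges [] = []
  walkEdges (step e _ p) = e ∷ walkEdges p

  IsPath : ∀ {u v} → Walk u v → Set
  IsPath p = Unique (walkVertices p)

  IsCycle : ∀ {u} → Walk u u → Set
  IsCycle [] = Data.Empty.⊥ where import Data.Empty
  IsCycle (step e j p) = Unique (walkEdges (step e j p)) × Unique (walkVertices p)

  Connected : Set
  Connected = ∀ u v → Walk u v

  Acyclic : Set
  Acyclic = ∀ u (c : Walk u u) → ¬ IsCycle c

  IsTree : Set
  IsTree = 1 ≤ n × Connected × Acyclic

  Is13Tree : Set
  Is13Tree = IsTree × (∀ v → deg v ≡ 1 ⊎ deg v ≡ 3)

  IsLeaf : Fin n → Set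
  IsLeaf v = deg v ≡ 1

  IsInternal : Fin n → Set
  IsInternal v = deg v ≡ 3

  Incident : Fin m → Fin n → Set
  Incident e v = src e ≡ v ⊎ tgt e ≡ v

  IsLeafEdge : Fin m → Set
  IsLeafEdge e = IsLeaf (src e) ⊎ IsLeaf (tgt e)

  -- leaf-path: a path of positive length whose extreme edges are leaf-edges,
  -- the leaf being the extreme vertex (so a single edge is a leaf-path iff it
  -- joins two leaves)
  IsLeafPath : ∀ {u v} → Walk u v → Set
  IsLeafPath {u} {v} p = IsPath p × 1 ≤ length (walkEdges p) × IsLeaf u × IsLeaf v

  LeafPath : Set
  LeafPath = Σ (Fin n) λ u → Σ (Fin n) λ v → Σ (Walk u v) IsLeafPath

  lpVertices : LeafPath → List (Fin n)
  lpVertices (_ , _ , p , _) = walkVertices p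

  lpEdges : LeafPath → List (Fin m)
  lpEdges (_ , _ , p , _) = walkEdges p

  InP : (Fin m → ℚ) → Set
  InP w =
    (m ≡ 1 → ∀ e → 0ℚ ≤ℚ w e × w e ≤ℚ ½) ×
    (∀ v → IsInternal v → ∀ a b c →
       Incident a v → Incident b v → Incident c v →
       a ≢ b → a ≢ c → b ≢ c →
       w a ≤ℚ w b + w c × w b ≤ℚ w a + w c × w c ≤ℚ w a + w b ×
       w a + w b + w c ≤ℚ 1ℚ)

  SupportIsDisjointLeafPaths : (Fin m → ℚ) → Set
  SupportIsDisjointLeafPaths w =
    Σ (List LeafPath) λ ps →
      AllPairs (λ p q → Disjoint (lpVertices p) (lpVertices q)) ps ×
      (∀ e → (w e ≢ 0ℚ → Any (λ p → e ∈ₗ lpEdges p) ps) ×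
             (Any (λ p → e ∈ₗ lpEdges p) ps → w e ≢ 0ℚ))

-- Read a Boolean edge labelling S as the point ½·S. The inequalities at an internal node then say
-- exactly that S is even there (zero or two of its three edges true), and the leaf-edges of X
-- are those labelled true. Adding up mod 2 the walks from a fixed root to the leaves of X gives
-- such an S.
--
-- Uniqueness: if a point of P_T agrees with ½·S on two edges at an internal node, the inequalities
-- force agreement on the third. So an edge of disagreement continues, without backtracking, along
-- further such edges; in a tree this is a path, which must end at a leaf-edge, where both agree.
--
-- The same propagation inside the support of an even S runs from any leaf of the support to another
-- leaf. By evenness no other support edge touches this leaf-path, so removing it leaves an even
-- labelling, and induction produces the vertex-disjoint leaf-paths.

{-# OPTIONS --safe #-}
module Submission where
open import Defs
open import Algebra.Bundles using (CommutativeRing)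
open import Data.Bool using (Bool; true; false; _xor_; _∨_; _∧_; not; if_then_else_)
open import Data.Bool.Properties using (xor-assoc; xor-same; xor-comm; xor-∧-commutativeRing; ∧-identityʳ)
open import Data.Empty using (⊥; ⊥-elim)
open import Data.Unit using (⊤; tt)
open import Data.Fin using (Fin; zero; suc; _≟_; fromℕ<)
open import Data.Fin.Properties using (injective⇒≤)
open import Data.Fin.Subset using (Subset; _∈_; _∉_; ∣_∣)
open import Data.Fin.Subset.Properties using (_∈?_)
open import Data.Vec.Properties using ([]=⇒lookup; lookup⇒[]=)
open import Data.List using (List; []; _∷_; length; lookup; map; concatMap; _++_; filter; allFin)
open import Data.List.Membership.Propositional using (lose) renaming (_∈_ to _∈ₗ_)
open import Data.List.Membership.Propositional.Properties
  using (∈-lookup; ∈-map⁻; ∈-filter⁺; ∈-filter⁻; ∈-allFin)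
open import Data.List.Properties using (length-map; length-tabulate)
open import Data.List.Relation.Binary.Subset.Propositional using (_⊆_)
open import Data.List.Relation.Unary.All as All using (All; []; _∷_)
open import Data.List.Relation.Unary.AllPairs using (AllPairs; []; _∷_)
open import Data.List.Relation.Binary.Disjoint.Propositional using (Disjoint)
open import Data.List.Relation.Unary.Any using (Any; here; there; index; any?)
open import Data.List.Relation.Unary.Any.Properties using (lookup-index)
open import Data.List.Relation.Unary.Unique.Propositional using (Unique)
import Data.List.Relation.Unary.Unique.Propositional.Properties as Unique
open import Data.Nat using (ℕ; zero; suc; _≤_; z≤n; s≤s)
import Data.Nat as ℕ
open import Data.Nat.Properties using (≤-reflexive; ≤-trans; <-irrefl; n≤1+n; 1+n≰n; module ≤-Reasoning)
open import Data.Nat.Divisibility using (_∣_; ∣1⇒≡1; ∣m+n∣m⇒∣n; ∣-refl)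
open import Data.Product using (Σ; _×_; _,_; proj₁; proj₂)
open import Data.Rational using (ℚ; 0ℚ; ½; 1ℚ; _+_; -_; _≤?_) renaming (_≤_ to _≤ℚ_; _≟_ to _≟ℚ_)
open import Data.Rational.Properties using (≤-antisym; +-assoc; +-identityʳ; +-inverseʳ; +-monoˡ-≤)
open import Data.Sum using (_⊎_; inj₁; inj₂) renaming (map₂ to map⊎₂)
open import Data.Vec using (_∷_; []) renaming (lookup to lookupᵛ; here to here[]; there to there[])
open import Function using (_∘_; id)
open import Relation.Binary.PropositionalEquality
open import Relation.Nullary using (¬_; Dec; yes; no; does)
open import Relation.Nullary.Decidable using (True; toWitness; _×-dec_; _⊎-dec_; dec-true; dec-false)

open import Algebra.Properties.CommutativeSemigroup
  (CommutativeRing.+-commutativeSemigroup xor-∧-commutativeRing) using (interchange)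

Unique-lookup-injective : ∀ {A : Set} {xs : List A} → Unique xs →
  ∀ {i j} → lookup xs i ≡ lookup xs j → i ≡ j
Unique-lookup-injective {xs = _ ∷ _} _         {zero}  {zero}  eq = refl
Unique-lookup-injective {xs = _ ∷ _} (x∉ ∷ _) {zero}  {suc j} eq = ⊥-elim (All.lookup x∉ (∈-lookup j) eq)
Unique-lookup-injective {xs = _ ∷ _} (x∉ ∷ _) {suc i} {zero}  eq = ⊥-elim (All.lookup x∉ (∈-lookup i) (sym eq))
Unique-lookup-injective {xs = _ ∷ _} (_ ∷ u)  {suc i} {suc j} eq = cong suc (Unique-lookup-injective u eq)

Unique⇒length≤ : ∀ {A : Set} {xs ys : List A} → Unique xs → xs ⊆ ys → length xs ≤ length ys
Unique⇒length≤ {xs = xs} {ys} u xs⊆ys = injective⇒≤ position-injective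
  where
  position : Fin (length xs) → Fin (length ys)
  position i = index (xs⊆ys (∈-lookup i))
  position-injective : ∀ {i j} → position i ≡ position j → i ≡ j
  position-injective {i} {j} eq = Unique-lookup-injective u (begin
    lookup xs i              ≡⟨ lookup-index (xs⊆ys (∈-lookup i)) ⟩
    lookup ys (position i)   ≡⟨ cong (lookup ys) eq ⟩
    lookup ys (position j)   ≡⟨ lookup-index (xs⊆ys (∈-lookup j)) ⟨
    lookup xs j              ∎)
    where open ≡-Reasoning

∃-∈ : ∀ {A : Set} {xs : List A} → 1 ≤ length xs → Σ A (_∈ₗ xs)
∃-∈ {xs = x ∷ _} _ = x , here refl

other-two : ∀ {A : Set} {xs : List A} → Unique xs → length xs ≡ 3 → ∀ {g} → g ∈ₗ xs →
  Σ A λ b → Σ A λ c → b ∈ₗ xs × c ∈ₗ xs × g ≢ b × g ≢ c × b ≢ c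
other-two {xs = p ∷ q ∷ r ∷ []} ((p≢q ∷ p≢r ∷ []) ∷ (q≢r ∷ []) ∷ _) refl (here refl) =
  q , r , there (here refl) , there (there (here refl)) , p≢q , p≢r , q≢r
other-two {xs = p ∷ q ∷ r ∷ []} ((p≢q ∷ p≢r ∷ []) ∷ (q≢r ∷ []) ∷ _) refl (there (here refl)) =
  p , r , here refl , there (there (here refl)) , p≢q ∘ sym , q≢r , p≢r
other-two {xs = p ∷ q ∷ r ∷ []} ((p≢q ∷ p≢r ∷ []) ∷ (q≢r ∷ []) ∷ _) refl (there (there (here refl))) =
  p , q , here refl , there (here refl) , p≢r ∘ sym , q≢r ∘ sym , p≢q

-- Sums in GF(2)

true≢false : true ≢ false
true≢false ()

xor-telescope : ∀ a b c → (a xor b) xor (b xor c) ≡ a xor c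
xor-telescope a b c = begin
  (a xor b) xor (b xor c)  ≡⟨ xor-assoc a b (b xor c) ⟩
  a xor (b xor (b xor c))  ≡⟨ cong (a xor_) (xor-assoc b b c) ⟨
  a xor ((b xor b) xor c)  ≡⟨ cong (λ d → a xor (d xor c)) (xor-same b) ⟩
  a xor c                  ∎
  where open ≡-Reasoning

parity : ∀ {A : Set} → (A → Bool) → List A → Bool
parity p []       = false
parity p (x ∷ xs) = p x xor parity p xs

module _ {A : Set} where

  parity-++ : ∀ (p : A → Bool) xs ys → parity p (xs ++ ys) ≡ parity p xs xor parity p ys
  parity-++ p []       ys = refl
  parity-++ p (x ∷ xs) ys =
    trans (cong (p x xor_) (parity-++ p xs ys)) (sym (xor-assoc (p x) (parity p xs) (parity p ys)))

  parity-concatMap : ∀ {B : Set} (p : A → Bool) (f : B → List A) xs →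
    parity p (concatMap f xs) ≡ parity (parity p ∘ f) xs
  parity-concatMap p f []       = refl
  parity-concatMap p f (x ∷ xs) =
    trans (parity-++ p (f x) (concatMap f xs)) (cong (parity p (f x) xor_) (parity-concatMap p f xs))

  parity-map : ∀ {B : Set} (p : A → Bool) (f : B → A) xs → parity p (map f xs) ≡ parity (p ∘ f) xs
  parity-map p f []       = refl
  parity-map p f (x ∷ xs) = cong (p (f x) xor_) (parity-map p f xs)

  parity-xor : ∀ (p q : A → Bool) xs → parity (λ x → p x xor q x) xs ≡ parity p xs xor parity q xs
  parity-xor p q []       = refl
  parity-xor p q (x ∷ xs) =
    trans (cong ((p x xor q x) xor_) (parity-xor p q xs)) (interchange (p x) (q x) (parity p xs) (parity q xs))

  parity-cong : ∀ {p q : A → Bool} xs → (∀ {x} → x ∈ₗ xs → p x ≡ q x) → parity p xs ≡ parity q xs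
  parity-cong []       p≗q = refl
  parity-cong (x ∷ xs) p≗q = cong₂ _xor_ (p≗q (here refl)) (parity-cong xs (p≗q ∘ there))

  parity-false : ∀ {p : A → Bool} xs → (∀ {x} → x ∈ₗ xs → p x ≡ false) → parity p xs ≡ false
  parity-false []       p≡false = refl
  parity-false (x ∷ xs) p≡false rewrite p≡false (here refl) = parity-false xs (p≡false ∘ there)

  parity-const-even : ∀ b (xs : List A) → 2 ∣ length xs → parity (λ _ → b) xs ≡ false
  parity-const-even b []           _    = refl
  parity-const-even b (x ∷ [])     2∣1  with () ← ∣1⇒≡1 2∣1
  parity-const-even b (x ∷ y ∷ xs) 2∣xs = begin
    b xor (b xor parity (λ _ → b) xs)  ≡⟨ xor-assoc b b _ ⟨
    (b xor b) xor parity (λ _ → b) xs  ≡⟨ cong (_xor parity (λ _ → b) xs) (xor-same b) ⟩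
    parity (λ _ → b) xs                ≡⟨ parity-const-even b xs (∣m+n∣m⇒∣n 2∣xs ∣-refl) ⟩
    false                              ∎
    where open ≡-Reasoning

oddIn : ∀ {m} → List (Fin m) → Fin m → Bool
oddIn E e = parity (λ g → does (e ≟ g)) E

erase : ∀ {m} → (Fin m → Bool) → List (Fin m) → Fin m → Bool
erase S E g = S g ∧ not (does (any? (g ≟_) E))

erase-true : ∀ {m} (S : Fin m → Bool) E {g} → erase S E g ≡ true → S g ≡ true × ¬ g ∈ₗ E
erase-true S E {g} erased with S g | any? (g ≟_) E
erase-true S E _  | true  | no g∉E = refl , g∉E
erase-true S E () | true  | yes _
erase-true S E () | false | _

erase-∉ : ∀ {m} (S : Fin m → Bool) {E g} → ¬ g ∈ₗ E → erase S E g ≡ S g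
erase-∉ S {E} {g} g∉E with any? (g ≟_) E
... | yes g∈E = ⊥-elim (g∉E g∈E)
... | no _    = ∧-identityʳ (S g)

elements : ∀ {m} → Subset m → List (Fin m)
elements []           = []
elements (true ∷ X)  = zero ∷ map suc (elements X)
elements (false ∷ X) = map suc (elements X)

length-elements : ∀ {m} (X : Subset m) → length (elements X) ≡ ∣ X ∣
length-elements []          = refl
length-elements (true ∷ X)  = cong suc (trans (length-map suc (elements X)) (length-elements X))
length-elements (false ∷ X) = trans (length-map suc (elements X)) (length-elements X)

∈-elements⁻ : ∀ {m} (X : Subset m) {f} → f ∈ₗ elements X → f ∈ X
∈-elements⁻ (true ∷ X)  (here refl) = here[]
∈-elements⁻ (true ∷ X)  (there f∈)
  with _ , f∈′ , refl ← ∈-map⁻ suc f∈ = there[] (∈-elements⁻ X f∈′)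
∈-elements⁻ (false ∷ X) f∈
  with _ , f∈′ , refl ← ∈-map⁻ suc f∈ = there[] (∈-elements⁻ X f∈′)

∉⇒lookup≡false : ∀ {m} {X : Subset m} {e} → e ∉ X → lookupᵛ X e ≡ false
∉⇒lookup≡false {X = X} {e} e∉X with lookupᵛ X e in X[e]
... | true  = ⊥-elim (e∉X (lookup⇒[]= e X X[e]))
... | false = refl

parity-elements : ∀ {m} (X : Subset m) e → parity (λ f → does (f ≟ e)) (elements X) ≡ lookupᵛ X e
parity-elements (true ∷ X)  zero    =
  cong (true xor_) (trans (parity-map _ suc (elements X)) (parity-false (elements X) (λ _ → refl)))
parity-elements (false ∷ X) zero    =
  trans (parity-map _ suc (elements X)) (parity-false (elements X) (λ _ → refl))
parity-elements (true ∷ X)  (suc e) = trans (parity-map _ suc (elements X)) (parity-elements X e)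
parity-elements (false ∷ X) (suc e) = trans (parity-map _ suc (elements X)) (parity-elements X e)

-- Points with coordinates in {0, ½}

half : Bool → ℚ
half b = if b then ½ else 0ℚ

Triangle : ℚ → ℚ → ℚ → Set
Triangle p q r = p ≤ℚ q + r × q ≤ℚ p + r × r ≤ℚ p + q × p + q + r ≤ℚ 1ℚ

triangle? : ∀ p q r → Dec (Triangle p q r)
triangle? p q r = (p ≤? q + r) ×-dec (q ≤? p + r) ×-dec (r ≤? p + q) ×-dec (p + q + r ≤? 1ℚ)

half-triangle : ∀ a b c → a xor (b xor c) ≡ false → Triangle (half a) (half b) (half c)
half-triangle a b c even = toWitness (decided a b c even)
  where
  decided : ∀ a b c → a xor (b xor c) ≡ false → True (triangle? (half a) (half b) (half c))
  decided false false false _ = _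
  decided false true  true  _ = _
  decided true  false true  _ = _
  decided true  true  false _ = _
  decided false false true  ()
  decided false true  false ()
  decided true  false false ()
  decided true  true  true  ()

half-bounds : ∀ b → 0ℚ ≤ℚ half b × half b ≤ℚ ½
half-bounds true  = toWitness {a? = (0ℚ ≤? ½) ×-dec (½ ≤? ½)} _
half-bounds false = toWitness {a? = (0ℚ ≤? 0ℚ) ×-dec (0ℚ ≤? ½)} _

half-values : ∀ b → half b ≡ 0ℚ ⊎ half b ≡ ½
half-values true  = inj₂ refl
half-values false = inj₁ refl

half≢0⇒true : ∀ {b} → half b ≢ 0ℚ → b ≡ true
half≢0⇒true {true}  _      = refl
half≢0⇒true {false} half≢0 = ⊥-elim (half≢0 refl)

true⇒half≢0 : ∀ {b} → b ≡ true → half b ≢ 0ℚ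
true⇒half≢0 refl ()

+-cancelʳ-≤ : ∀ {p q} r → p + r ≤ℚ q + r → p ≤ℚ q
+-cancelʳ-≤ {p} {q} r le = subst₂ _≤ℚ_ (cancel p) (cancel q) (+-monoˡ-≤ (- r) le)
  where
  cancel : ∀ s → s + r + - r ≡ s
  cancel s = trans (+-assoc s r (- r)) (trans (cong (s +_) (+-inverseʳ r)) (+-identityʳ s))

triangle-half-determined : ∀ p b c → Triangle p (half b) (half c) → p ≡ half (b xor c)
triangle-half-determined p false false (p≤ , ≤p , _ , _) =
  ≤-antisym p≤ (subst (0ℚ ≤ℚ_) (+-identityʳ p) ≤p)
triangle-half-determined p true false (_ , ≤p , _ , sum≤) =
  ≤-antisym (+-cancelʳ-≤ ½ (subst (_≤ℚ 1ℚ) (+-identityʳ (p + ½)) sum≤))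
            (subst (½ ≤ℚ_) (+-identityʳ p) ≤p)
triangle-half-determined p false true (_ , _ , ≤p , sum≤) =
  ≤-antisym (+-cancelʳ-≤ ½ (subst (λ s → s + ½ ≤ℚ 1ℚ) (+-identityʳ p) sum≤))
            (subst (½ ≤ℚ_) (+-identityʳ p) ≤p)
triangle-half-determined p true true (_ , ≤p , _ , sum≤) =
  ≤-antisym (+-cancelʳ-≤ 1ℚ (subst (_≤ℚ 1ℚ) (+-assoc p ½ ½) sum≤)) (+-cancelʳ-≤ ½ ≤p)

-- Incidences, walks and parities in a finite graph

module _ {n m : ℕ} (G : Graph n m) where
  open Graph G

  incident? : ∀ e v → Dec (Incident G e v)
  incident? e v = (src e ≟ v) ⊎-dec (tgt e ≟ v)

  incidentEdges : Fin n → List (Fin m)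
  incidentEdges v = filter (λ e → incident? e v) (allFin m)

  ∈-incidentEdges⁺ : ∀ {e v} → Incident G e v → e ∈ₗ incidentEdges v
  ∈-incidentEdges⁺ {e} {v} = ∈-filter⁺ (λ e → incident? e v) (∈-allFin e)

  ∈-incidentEdges⁻ : ∀ {e v} → e ∈ₗ incidentEdges v → Incident G e v
  ∈-incidentEdges⁻ {v = v} = proj₂ ∘ ∈-filter⁻ (λ e → incident? e v) {xs = allFin m}

  incidentEdges-unique : ∀ v → Unique (incidentEdges v)
  incidentEdges-unique v = Unique.filter⁺ (λ e → incident? e v) (Unique.allFin⁺ m)

  leaf≢internal : ∀ {v} → IsLeaf G v → ¬ IsInternal G v
  leaf≢internal leaf internal with () ← trans (sym leaf) internal

  leaf-edge : ∀ {v} → IsLeaf G v → Σ (Fin m) λ e → Incident G e v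
  leaf-edge leaf with e , e∈ ← ∃-∈ (≤-reflexive (sym leaf)) = e , ∈-incidentEdges⁻ e∈

  leaf-edge-unique : ∀ {v g h} → IsLeaf G v → Incident G g v → Incident G h v → g ≡ h
  leaf-edge-unique {v} {g} {h} leaf g∼v h∼v with g ≟ h
  ... | yes g≡h = g≡h
  ... | no g≢h =
    ⊥-elim (<-irrefl refl (subst (2 ≤_) leaf (Unique⇒length≤ ((g≢h ∷ []) ∷ [] ∷ []) ⊆incident)))
    where
    ⊆incident : g ∷ h ∷ [] ⊆ incidentEdges v
    ⊆incident (here refl)         = ∈-incidentEdges⁺ g∼v
    ⊆incident (there (here refl)) = ∈-incidentEdges⁺ h∼v

  internal-other-edges : ∀ {v g} → IsInternal G v → Incident G g v →
    Σ (Fin m) λ b → Σ (Fin m) λ c → Incident G b v × Incident G c v × g ≢ b × g ≢ c × b ≢ c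
  internal-other-edges {v} internal g∼v
    with b , c , b∈ , c∈ , distinct ← other-two (incidentEdges-unique v) internal (∈-incidentEdges⁺ g∼v) =
    b , c , ∈-incidentEdges⁻ b∈ , ∈-incidentEdges⁻ c∈ , distinct

  internal-no-fourth-edge : ∀ {v a b c g} → IsInternal G v →
    Incident G a v → Incident G b v → Incident G c v → a ≢ b → a ≢ c → b ≢ c →
    Incident G g v → g ≢ a → g ≢ b → g ≢ c → ⊥
  internal-no-fourth-edge {v} {a} {b} {c} {g} internal a∼v b∼v c∼v a≢b a≢c b≢c g∼v g≢a g≢b g≢c
    = <-irrefl refl (subst (4 ≤_) internal (Unique⇒length≤ distinct ⊆incident))
    where
    distinct : Unique (g ∷ a ∷ b ∷ c ∷ [])
    distinct = (g≢a ∷ g≢b ∷ g≢c ∷ []) ∷ (a≢b ∷ a≢c ∷ []) ∷ (b≢c ∷ []) ∷ [] ∷ []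
    ⊆incident : g ∷ a ∷ b ∷ c ∷ [] ⊆ incidentEdges v
    ⊆incident (here refl)                         = ∈-incidentEdges⁺ g∼v
    ⊆incident (there (here refl))                 = ∈-incidentEdges⁺ a∼v
    ⊆incident (there (there (here refl)))         = ∈-incidentEdges⁺ b∼v
    ⊆incident (there (there (there (here refl)))) = ∈-incidentEdges⁺ c∼v

  leafEnd : Fin m → Fin n
  leafEnd f with deg G (src f) ℕ.≟ 1
  ... | yes _ = src f
  ... | no _  = tgt f

  leafEnd-leaf : ∀ {f} → IsLeafEdge G f → IsLeaf G (leafEnd f)
  leafEnd-leaf {f} leafEdge with deg G (src f) ℕ.≟ 1 | leafEdge
  ... | yes leaf | _           = leaf
  ... | no ¬leaf | inj₁ leaf   = ⊥-elim (¬leaf leaf)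
  ... | no _     | inj₂ leaf   = leaf

  leafEnd-incident : ∀ f → Incident G f (leafEnd f)
  leafEnd-incident f with deg G (src f) ℕ.≟ 1
  ... | yes _ = inj₁ refl
  ... | no _  = inj₂ refl

  incident-leaf⇒IsLeafEdge : ∀ {h t} → Incident G h t → IsLeaf G t → IsLeafEdge G h
  incident-leaf⇒IsLeafEdge (inj₁ refl) leaf = inj₁ leaf
  incident-leaf⇒IsLeafEdge (inj₂ refl) leaf = inj₂ leaf

  joins-incidentˡ : ∀ {e u w} → Joins G e u w → Incident G e u
  joins-incidentˡ (inj₁ (s≡u , _)) = inj₁ s≡u
  joins-incidentˡ (inj₂ (_ , t≡u)) = inj₂ t≡u

  joins-incidentʳ : ∀ {e u w} → Joins G e u w → Incident G e w
  joins-incidentʳ (inj₁ (_ , t≡w)) = inj₂ t≡w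
  joins-incidentʳ (inj₂ (s≡w , _)) = inj₁ s≡w

  opposite : Fin m → Fin n → Fin n
  opposite g v = if does (src g ≟ v) then tgt g else src g

  joins-opposite : ∀ {g v} → Incident G g v → Joins G g v (opposite g v)
  joins-opposite {g} {v} g∼v with src g ≟ v | g∼v
  ... | yes s≡v | _        = inj₁ (s≡v , refl)
  ... | no s≢v  | inj₁ s≡v = ⊥-elim (s≢v s≡v)
  ... | no _    | inj₂ t≡v = inj₂ (refl , t≡v)

  start∈walkVertices : ∀ {u v} (p : Walk G u v) → u ∈ₗ walkVertices G p
  start∈walkVertices []           = here refl
  start∈walkVertices (step _ _ _) = here refl

  end∈walkVertices : ∀ {u v} (p : Walk G u v) → v ∈ₗ walkVertices G p
  end∈walkVertices []           = here refl
  end∈walkVertices (step _ _ p) = there (end∈walkVertices p)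

  length-walkVertices : ∀ {u v} (p : Walk G u v) → length (walkVertices G p) ≡ suc (length (walkEdges G p))
  length-walkVertices []           = refl
  length-walkVertices (step _ _ p) = cong suc (length-walkVertices p)

  incident∈walkVertices : ∀ {u v} (p : Walk G u v) {e x} →
    e ∈ₗ walkEdges G p → Incident G e x → x ∈ₗ walkVertices G p
  incident∈walkVertices (step e j p) (here refl) e∼x with j | e∼x
  ... | inj₁ (refl , _) | inj₁ refl = here refl
  ... | inj₁ (_ , refl) | inj₂ refl = there (start∈walkVertices p)
  ... | inj₂ (refl , _) | inj₁ refl = there (start∈walkVertices p)
  ... | inj₂ (_ , refl) | inj₂ refl = here refl
  incident∈walkVertices (step e j p) (there e∈) e∼x = there (incident∈walkVertices p e∈ e∼x)

  IsPath⇒Unique-walkEdges : ∀ {u v} (p : Walk G u v) → IsPath G p → Unique (walkEdges G p)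
  IsPath⇒Unique-walkEdges []           _          = []
  IsPath⇒Unique-walkEdges (step e j p) (u∉p ∷ path) =
    All.tabulate (λ e′∈ e≡e′ →
      All.lookup u∉p (incident∈walkVertices p (subst (_∈ₗ _) (sym e≡e′) e′∈) (joins-incidentˡ j)) refl)
    ∷ IsPath⇒Unique-walkEdges p path

  path-length< : ∀ {u v} (p : Walk G u v) → IsPath G p → suc (length (walkEdges G p)) ≤ n
  path-length< p path = begin
    suc (length (walkEdges G p))  ≡⟨ length-walkVertices p ⟨
    length (walkVertices G p)     ≤⟨ Unique⇒length≤ path (λ {x} _ → ∈-allFin x) ⟩
    length (allFin n)             ≡⟨ length-tabulate id ⟩
    n                             ∎
    where open ≤-Reasoning

  NonBacktrackingAfter : Fin m → ∀ {u v} → Walk G u v → Set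
  NonBacktrackingAfter g []           = ⊤
  NonBacktrackingAfter g (step e _ p) = g ≢ e × NonBacktrackingAfter e p

  NonBacktracking : ∀ {u v} → Walk G u v → Set
  NonBacktracking []           = ⊤
  NonBacktracking (step e _ p) = NonBacktrackingAfter e p

  NonBacktrackingAfter⇒NonBacktracking : ∀ {g u v} (p : Walk G u v) →
    NonBacktrackingAfter g p → NonBacktracking p
  NonBacktrackingAfter⇒NonBacktracking []           _        = tt
  NonBacktrackingAfter⇒NonBacktracking (step _ _ _) (_ , nb) = nb

  prefix : ∀ {w t z} (p : Walk G w t) → z ∈ₗ walkVertices G p →
    Σ (Walk G w z) λ q → walkVertices G q ⊆ walkVertices G p ×
      (∀ {g} → NonBacktrackingAfter g p → NonBacktrackingAfter g q) × (IsPath G p → IsPath G q)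
  prefix []           (here refl) = [] , (λ { (here refl) → here refl }) , (λ _ → tt) , (λ path → path)
  prefix (step e j p) (here refl) = [] , (λ { (here refl) → here refl }) , (λ _ → tt) , (λ _ → [] ∷ [])
  prefix (step e j p) (there z∈) with q , q⊆p , nb , path ← prefix p z∈ =
    step e j q ,
    (λ { (here refl) → here refl ; (there x∈) → there (q⊆p x∈) }) ,
    (λ { (g≢e , nbp) → g≢e , nb nbp }) ,
    (λ { (w∉p ∷ pathp) → All.tabulate (All.lookup w∉p ∘ q⊆p) ∷ path pathp })

  Acyclic⇒loopless : Acyclic G → ∀ {e u w} → Joins G e u w → u ≢ w
  Acyclic⇒loopless acyclic {e} j refl = acyclic _ (step e j []) (([] ∷ []) , ([] ∷ []))

  -- If u reappeared on p, the prefix of p back to u would close a cycle with e; non-backtracking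
  -- keeps e off that prefix.
  Acyclic⇒NonBacktracking⇒IsPath : Acyclic G → ∀ {u v} (p : Walk G u v) → NonBacktracking p → IsPath G p
  Acyclic⇒NonBacktracking⇒IsPath acyclic []                          _  = [] ∷ []
  Acyclic⇒NonBacktracking⇒IsPath acyclic {u} (step {w = w} e j p) nb =
    All.tabulate (λ x∈ u≡x → u∉p (subst (_∈ₗ walkVertices G p) (sym u≡x) x∈)) ∷ path
    where
    path : IsPath G p
    path = Acyclic⇒NonBacktracking⇒IsPath acyclic p (NonBacktrackingAfter⇒NonBacktracking p nb)
    e∉ : (q : Walk G w u) → NonBacktrackingAfter e q → IsPath G q → All (e ≢_) (walkEdges G q)
    e∉ []             _           _              = []
    e∉ (step e′ _ q′) (e≢e′ , _) (w∉q′ ∷ _) =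
      e≢e′ ∷ All.tabulate (λ e″∈ e≡e″ →
        All.lookup w∉q′
          (incident∈walkVertices q′ (subst (_∈ₗ _) (sym e≡e″) e″∈) (joins-incidentʳ j)) refl)
    u∉p : ¬ u ∈ₗ walkVertices G p
    u∉p u∈ with q , _ , nbq , pathq ← prefix p u∈ =
      acyclic u (step e j q)
        (e∉ q (nbq nb) (pathq path) ∷ IsPath⇒Unique-walkEdges q (pathq path) , pathq path)

  incident-walkEdge : ∀ {u v z} (p : Walk G u v) → 1 ≤ length (walkEdges G p) → z ∈ₗ walkVertices G p →
    Σ (Fin m) λ g → g ∈ₗ walkEdges G p × Incident G g z
  incident-walkEdge (step e j p) _ (here refl) = e , here refl , joins-incidentˡ j
  incident-walkEdge (step e j []) _ (there (here refl)) = e , here refl , joins-incidentʳ j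
  incident-walkEdge (step e j p@(step _ _ _)) _ (there z∈)
    with g , g∈ , g∼z ← incident-walkEdge p (s≤s z≤n) z∈ = g , there g∈ , g∼z

  interior-walkEdges : ∀ {u v z} (p : Walk G u v) → IsPath G p →
    z ∈ₗ walkVertices G p → z ≢ u → z ≢ v →
    Σ (Fin m) λ g₁ → Σ (Fin m) λ g₂ →
      g₁ ∈ₗ walkEdges G p × g₂ ∈ₗ walkEdges G p × Incident G g₁ z × Incident G g₂ z × g₁ ≢ g₂
  interior-walkEdges []  _ (here refl) z≢u _ = ⊥-elim (z≢u refl)
  interior-walkEdges (step e j p) _ (here refl) z≢u _ = ⊥-elim (z≢u refl)
  interior-walkEdges (step e j []) _ (there (here refl)) _ z≢v = ⊥-elim (z≢v refl)
  interior-walkEdges (step e j (step e′ j′ p)) (u∉ ∷ _) (there (here refl)) _ _ =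
    e , e′ , here refl , there (here refl) , joins-incidentʳ j , joins-incidentˡ j′ , e≢e′
    where
    e≢e′ : e ≢ e′
    e≢e′ refl = All.lookup u∉ (incident∈walkVertices (step e j′ p) (here refl) (joins-incidentˡ j)) refl
  interior-walkEdges (step e j p@(step _ _ _)) (_ ∷ path@(w∉ ∷ _)) (there (there z∈)) _ z≢v
    with g₁ , g₂ , g₁∈ , g₂∈ , distinct ←
           interior-walkEdges p path (there z∈) (λ z≡w → All.lookup w∉ z∈ (sym z≡w)) z≢v =
    g₁ , g₂ , there g₁∈ , there g₂∈ , distinct

  incidenceParity : Fin n → List (Fin m) → Bool
  incidenceParity v = parity (λ g → does (incident? g v))

  joins-incidence : ∀ {e u w v} → Joins G e u w → u ≢ w →
    does (incident? e v) ≡ does (u ≟ v) xor does (w ≟ v)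
  joins-incidence (inj₁ (refl , refl)) s≢t = ∨≡xor s≢t
    where
    ∨≡xor : ∀ {a b v : Fin n} → a ≢ b →
      does (a ≟ v) ∨ does (b ≟ v) ≡ does (a ≟ v) xor does (b ≟ v)
    ∨≡xor {a} {b} {v} a≢b with a ≟ v | b ≟ v
    ... | yes refl | yes refl = ⊥-elim (a≢b refl)
    ... | yes _    | no _     = refl
    ... | no _     | _        = refl
  joins-incidence {e} {u} {w} {v} (inj₂ (refl , refl)) t≢s =
    trans (joins-incidence {e} {w} {u} {v} (inj₁ (refl , refl)) (t≢s ∘ sym))
          (xor-comm (does (w ≟ v)) (does (u ≟ v)))

  incidenceParity-walk : Acyclic G → ∀ {u t v} (p : Walk G u t) →
    incidenceParity v (walkEdges G p) ≡ does (u ≟ v) xor does (t ≟ v)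
  incidenceParity-walk acyclic {u} {v = v} [] = sym (xor-same (does (u ≟ v)))
  incidenceParity-walk acyclic {u} {t} {v} (step {w = w} e j p) = begin
    does (incident? e v) xor incidenceParity v (walkEdges G p)
      ≡⟨ cong₂ _xor_ (joins-incidence j (Acyclic⇒loopless acyclic j)) (incidenceParity-walk acyclic p) ⟩
    (does (u ≟ v) xor does (w ≟ v)) xor (does (w ≟ v) xor does (t ≟ v))
      ≡⟨ xor-telescope (does (u ≟ v)) (does (w ≟ v)) (does (t ≟ v)) ⟩
    does (u ≟ v) xor does (t ≟ v) ∎
    where open ≡-Reasoning

  oddIn-internal : ∀ {v a b c} → IsInternal G v →
    Incident G a v → Incident G b v → Incident G c v → a ≢ b → a ≢ c → b ≢ c →
    ∀ E → oddIn E a xor (oddIn E b xor oddIn E c) ≡ incidenceParity v E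
  oddIn-internal {v} {a} {b} {c} internal a∼v b∼v c∼v a≢b a≢c b≢c E = begin
    oddIn E a xor (oddIn E b xor oddIn E c)
      ≡⟨ cong (oddIn E a xor_) (parity-xor (λ g → does (b ≟ g)) (λ g → does (c ≟ g)) E) ⟨
    oddIn E a xor parity (λ g → does (b ≟ g) xor does (c ≟ g)) E
      ≡⟨ parity-xor (λ g → does (a ≟ g)) (λ g → does (b ≟ g) xor does (c ≟ g)) E ⟨
    parity (λ g → does (a ≟ g) xor (does (b ≟ g) xor does (c ≟ g))) E
      ≡⟨ parity-cong E (λ {g} _ → pointwise g) ⟩
    incidenceParity v E ∎
    where
    open ≡-Reasoning
    pointwise : ∀ g → does (a ≟ g) xor (does (b ≟ g) xor does (c ≟ g)) ≡ does (incident? g v)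
    pointwise g with a ≟ g | b ≟ g | c ≟ g
    ... | yes refl | yes refl | _        = ⊥-elim (a≢b refl)
    ... | yes refl | no _     | yes refl = ⊥-elim (a≢c refl)
    ... | no _     | yes refl | yes refl = ⊥-elim (b≢c refl)
    ... | yes refl | no _     | no _     = sym (dec-true (incident? g v) a∼v)
    ... | no _     | yes refl | no _     = sym (dec-true (incident? g v) b∼v)
    ... | no _     | no _     | yes refl = sym (dec-true (incident? g v) c∼v)
    ... | no a≢g   | no b≢g   | no c≢g   = sym (dec-false (incident? g v) λ g∼v →
      internal-no-fourth-edge internal a∼v b∼v c∼v a≢b a≢c b≢c
        g∼v (a≢g ∘ sym) (b≢g ∘ sym) (c≢g ∘ sym))

  oddIn-leaf : ∀ {v e} → IsLeaf G v → Incident G e v → ∀ E → oddIn E e ≡ incidenceParity v E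
  oddIn-leaf {v} {e} leaf e∼v E = parity-cong E (λ {g} _ → pointwise g)
    where
    pointwise : ∀ g → does (e ≟ g) ≡ does (incident? g v)
    pointwise g with e ≟ g
    ... | yes refl = sym (dec-true (incident? g v) e∼v)
    ... | no e≢g   = sym (dec-false (incident? g v) (e≢g ∘ leaf-edge-unique leaf e∼v))

  EvenAtInternal : (Fin m → Bool) → Set
  EvenAtInternal S = ∀ v → IsInternal G v → ∀ a b c → Incident G a v → Incident G b v → Incident G c v →
    a ≢ b → a ≢ c → b ≢ c → S a xor (S b xor S c) ≡ false

  EvenAtInternal⇒half-InP : ∀ S → EvenAtInternal S → InP G (half ∘ S)
  EvenAtInternal⇒half-InP S even =
    (λ _ e → half-bounds (S e)) ,
    λ v internal a b c a∼v b∼v c∼v a≢b a≢c b≢c →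
      half-triangle (S a) (S b) (S c) (even v internal a b c a∼v b∼v c∼v a≢b a≢c b≢c)

  DisjointLeafPathsCovering : (Fin m → Set) → Set
  DisjointLeafPathsCovering F =
    Σ (List (LeafPath G)) λ ps →
      AllPairs (λ p q → Disjoint (lpVertices G p) (lpVertices G q)) ps ×
      (∀ e → (F e → Any (λ p → e ∈ₗ lpEdges G p) ps) × (Any (λ p → e ∈ₗ lpEdges G p) ps → F e))

  DisjointLeafPathsCovering-resp : ∀ {F F′ : Fin m → Set} →
    (∀ {e} → F e → F′ e) → (∀ {e} → F′ e → F e) →
    DisjointLeafPathsCovering F → DisjointLeafPathsCovering F′
  DisjointLeafPathsCovering-resp F⇒F′ F′⇒F (ps , disjoint , covers) =
    ps , disjoint , λ e → (proj₁ (covers e) ∘ F′⇒F) , (F⇒F′ ∘ proj₂ (covers e))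

  LeavesListed : (Fin m → Bool) → List (Fin n) → Set
  LeavesListed S vs = ∀ {w g} → IsLeaf G w → Incident G g w → S g ≡ true → w ∈ₗ vs

  LeavesListed-tail : ∀ {S w vs} → (∀ {g} → IsLeaf G w → Incident G g w → S g ≡ true → ⊥) →
    LeavesListed S (w ∷ vs) → LeavesListed S vs
  LeavesListed-tail unlisted listed leaf g∼z Sg with listed leaf g∼z Sg
  ... | here refl = ⊥-elim (unlisted leaf g∼z Sg)
  ... | there z∈  = z∈

-- {1,3}-trees

module _ {n m : ℕ} (T : Graph n m) (tree : Is13Tree T) where

  private
    connected = proj₁ (proj₂ (proj₁ tree))
    acyclic   = proj₂ (proj₂ (proj₁ tree))
    leaf-or-internal = proj₂ tree

  Propagates : (Fin m → Set) → Set
  Propagates Q = ∀ v → IsInternal T v → ∀ g → Incident T g v → Q g →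
    Σ (Fin m) λ h → Incident T h v × g ≢ h × Q h

  propagate-walk : ∀ {Q} → Propagates Q → ∀ k {v} g → Incident T g v → Q g →
    Σ (Fin n) λ t → Σ (Walk T v t) λ W → NonBacktrackingAfter T g W × All Q (walkEdges T W) ×
      (IsLeaf T t ⊎ length (walkEdges T W) ≡ k)
  propagate-walk propagates zero    {v} g _ _ = v , [] , tt , [] , inj₂ refl
  propagate-walk propagates (suc k) {v} g g∼v Qg with leaf-or-internal v
  ... | inj₁ leaf = v , [] , tt , [] , inj₁ leaf
  ... | inj₂ internal
    with h , h∼v , g≢h , Qh ← propagates v internal g g∼v Qg
    with t , W , nb , QW , leaf⊎long ←
           propagate-walk propagates k h (joins-incidentʳ T (joins-opposite T h∼v)) Qh =
    t , step h (joins-opposite T h∼v) W , (g≢h , nb) , Qh ∷ QW , map⊎₂ (cong suc) leaf⊎long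

  -- The walk is non-backtracking, hence a path, hence too short to exhaust n steps of fuel.
  propagate-to-leaf : ∀ {Q} → Propagates Q → ∀ {g u v} → Joins T g u v → Q g →
    Σ (Fin n) λ t → Σ (Walk T u t) λ W →
      IsPath T W × 1 ≤ length (walkEdges T W) × IsLeaf T t × All Q (walkEdges T W)
  propagate-to-leaf propagates {g} j Qg
    with t , W , nb , QW , leaf⊎long ← propagate-walk propagates n g (joins-incidentʳ T j) Qg
    with path ← Acyclic⇒NonBacktracking⇒IsPath T acyclic (step g j W) nb
    with leaf⊎long
  ... | inj₁ leaf = t , step g j W , path , s≤s z≤n , leaf , Qg ∷ QW
  ... | inj₂ long = ⊥-elim (1+n≰n (≤-trans (n≤1+n _)
    (subst (λ k → suc (suc k) ≤ n) long (path-length< T (step g j W) path))))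

  disagreement-propagates : ∀ S y → InP T (half ∘ S) → InP T y → Propagates (λ g → y g ≢ half (S g))
  disagreement-propagates S y (_ , S-triangles) (_ , y-triangles) v internal g g∼v y≢S
    with b , c , b∼v , c∼v , g≢b , g≢c , b≢c ← internal-other-edges T internal g∼v
    with y b ≟ℚ half (S b) | y c ≟ℚ half (S c)
  ... | no y≢Sb | _       = b , b∼v , g≢b , y≢Sb
  ... | yes _   | no y≢Sc = c , c∼v , g≢c , y≢Sc
  ... | yes y≡Sb | yes y≡Sc = ⊥-elim (y≢S (trans
    (triangle-half-determined (y g) (S b) (S c)
      (subst₂ (Triangle (y g)) y≡Sb y≡Sc (y-triangles v internal g b c g∼v b∼v c∼v g≢b g≢c b≢c)))
    (sym (triangle-half-determined (half (S g)) (S b) (S c)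
      (S-triangles v internal g b c g∼v b∼v c∼v g≢b g≢c b≢c)))))

  InP-determined-by-leafEdges : ∀ S y → InP T (half ∘ S) → InP T y →
    (∀ e → IsLeafEdge T e → y e ≡ half (S e)) → ∀ e → y e ≡ half (S e)
  InP-determined-by-leafEdges S y S∈P y∈P agree e with y e ≟ℚ half (S e)
  ... | yes y≡S = y≡S
  ... | no y≢S
    with t , W , _ , nonempty , leaf , disagree ←
           propagate-to-leaf (disagreement-propagates S y S∈P y∈P) (inj₁ (refl , refl)) y≢S
    with h , h∈ , h∼t ← incident-walkEdge T W nonempty (end∈walkVertices T W) =
    ⊥-elim (All.lookup disagree h∈ (agree h (incident-leaf⇒IsLeafEdge T h∼t leaf)))

  EvenAtInternal⇒Propagates : ∀ S → EvenAtInternal T S → Propagates (λ g → S g ≡ true)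
  EvenAtInternal⇒Propagates S even v internal g g∼v Sg
    with b , c , b∼v , c∼v , g≢b , g≢c , b≢c ← internal-other-edges T internal g∼v
    with S b in Sb | S c in Sc
  ... | true  | _     = b , b∼v , g≢b , Sb
  ... | false | true  = c , c∼v , g≢c , Sc
  ... | false | false =
    ⊥-elim (true≢false (trans (sym (cong₂ _xor_ Sg (cong₂ _xor_ Sb Sc)))
                              (even v internal g b c g∼v b∼v c∼v g≢b g≢c b≢c)))

  -- An interior vertex of P already has two S-edges on P, so evenness forbids a third S-edge there.
  touching-edge∈leafPath : ∀ S → EvenAtInternal T S → ∀ {w t} (P : Walk T w t) → IsLeafPath T P →
    All (λ g → S g ≡ true) (walkEdges T P) →
    ∀ {z g} → z ∈ₗ walkVertices T P → Incident T g z → S g ≡ true → g ∈ₗ walkEdges T P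
  touching-edge∈leafPath S even P (path , nonempty , leaf-w , leaf-t) SP {z} {g} z∈ g∼z Sg
    with leaf-or-internal z
  ... | inj₁ leaf-z with h , h∈ , h∼z ← incident-walkEdge T P nonempty z∈ =
    subst (_∈ₗ walkEdges T P) (leaf-edge-unique T leaf-z h∼z g∼z) h∈
  ... | inj₂ internal
    with g₁ , g₂ , g₁∈ , g₂∈ , g₁∼z , g₂∼z , g₁≢g₂ ← interior-walkEdges T P path z∈
           (λ { refl → leaf≢internal T leaf-w internal }) (λ { refl → leaf≢internal T leaf-t internal })
    with g ≟ g₁ | g ≟ g₂
  ... | yes refl | _        = g₁∈
  ... | no _     | yes refl = g₂∈
  ... | no g≢g₁  | no g≢g₂ = ⊥-elim (true≢false
    (trans (sym (cong₂ _xor_ Sg (cong₂ _xor_ (All.lookup SP g₁∈) (All.lookup SP g₂∈))))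
           (even z internal g g₁ g₂ g∼z g₁∼z g₂∼z g≢g₁ g≢g₂ g₁≢g₂)))

  module Peel (S : Fin m → Bool) (even : EvenAtInternal T S) {w t} (P : Walk T w t) (leafPath : IsLeafPath T P)
              (SP : All (λ g → S g ≡ true) (walkEdges T P)) where

    S′ : Fin m → Bool
    S′ = erase S (walkEdges T P)

    erase-touching : ∀ {z g} → z ∈ₗ walkVertices T P → Incident T g z → S′ g ≡ false
    erase-touching {g = g} z∈ g∼z with S′ g in erased
    ... | false = refl
    ... | true with Sg , g∉P ← erase-true S (walkEdges T P) erased =
      ⊥-elim (g∉P (touching-edge∈leafPath S even P leafPath SP z∈ g∼z Sg))

    erase-even : EvenAtInternal T S′
    erase-even v internal a b c a∼v b∼v c∼v a≢b a≢c b≢c with any? (v ≟_) (walkVertices T P)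
    ... | yes v∈ rewrite erase-touching v∈ a∼v | erase-touching v∈ b∼v | erase-touching v∈ c∼v = refl
    ... | no v∉ rewrite erase-∉ S (v∉ ∘ λ a∈ → incident∈walkVertices T P a∈ a∼v)
                      | erase-∉ S (v∉ ∘ λ b∈ → incident∈walkVertices T P b∈ b∼v)
                      | erase-∉ S (v∉ ∘ λ c∈ → incident∈walkVertices T P c∈ c∼v) =
      even v internal a b c a∼v b∼v c∼v a≢b a≢c b≢c

    erase-LeavesListed : ∀ {vs} → LeavesListed T S (w ∷ vs) → LeavesListed T S′ vs
    erase-LeavesListed listed =
      LeavesListed-tail T
        (λ _ g∼w S′g → true≢false (trans (sym S′g) (erase-touching (start∈walkVertices T P) g∼w)))
        (λ leaf g∼z S′g → listed leaf g∼z (proj₁ (erase-true S (walkEdges T P) S′g)))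

    cons-leafPath : DisjointLeafPathsCovering T (λ e → S′ e ≡ true) →
      DisjointLeafPathsCovering T (λ e → S e ≡ true)
    cons-leafPath (ps , disjoint , covers) =
      P′ ∷ ps , All.tabulate disjoint-P ∷ disjoint , λ e → onS e , S-on e
      where
      P′ : LeafPath T
      P′ = w , t , P , leafPath
      disjoint-P : ∀ {q} → q ∈ₗ ps → Disjoint (lpVertices T P′) (lpVertices T q)
      disjoint-P {_ , _ , Q , _ , nonempty , _} q∈ (z∈P , z∈Q)
        with g , g∈ , g∼z ← incident-walkEdge T Q nonempty z∈Q =
        true≢false (trans (sym (proj₂ (covers g) (lose q∈ g∈))) (erase-touching z∈P g∼z))
      onS : ∀ e → S e ≡ true → Any (λ p → e ∈ₗ lpEdges T p) (P′ ∷ ps)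
      onS e Se with any? (e ≟_) (walkEdges T P)
      ... | yes e∈P = here e∈P
      ... | no e∉P  = there (proj₁ (covers e) (trans (erase-∉ S e∉P) Se))
      S-on : ∀ e → Any (λ p → e ∈ₗ lpEdges T p) (P′ ∷ ps) → S e ≡ true
      S-on e (here e∈P)   = All.lookup SP e∈P
      S-on e (there e∈ps) = proj₁ (erase-true S (walkEdges T P) (proj₂ (covers e) e∈ps))

  decompose : ∀ vs S → EvenAtInternal T S → LeavesListed T S vs →
    DisjointLeafPathsCovering T (λ e → S e ≡ true)
  decompose [] S even listed = [] , [] , λ e → no-S-edge e , λ ()
    where
    no-S-edge : ∀ e → S e ≡ true → Any (λ p → e ∈ₗ lpEdges T p) []
    no-S-edge e Se
      with t , W , _ , nonempty , leaf , SW ←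
             propagate-to-leaf (EvenAtInternal⇒Propagates S even) (inj₁ (refl , refl)) Se
      with h , h∈ , h∼t ← incident-walkEdge T W nonempty (end∈walkVertices T W)
      with () ← listed leaf h∼t (All.lookup SW h∈)
  decompose (w ∷ vs) S even listed with leaf-or-internal w
  ... | inj₂ internal =
    decompose vs S even (LeavesListed-tail T (λ leaf _ _ → leaf≢internal T leaf internal) listed)
  ... | inj₁ leaf with e , e∼w ← leaf-edge T leaf with S e in Se
  ... | false = decompose vs S even (LeavesListed-tail T (λ _ g∼w Sg →
    true≢false (trans (sym Sg) (trans (cong S (leaf-edge-unique T leaf g∼w e∼w)) Se))) listed)
  ... | true
    with t , P , path , nonempty , leaf-t , SP ←
           propagate-to-leaf (EvenAtInternal⇒Propagates S even) (joins-opposite T e∼w) Se =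
    cons-leafPath (decompose vs S′ erase-even (erase-LeavesListed listed))
    where open Peel S even P (path , nonempty , leaf , leaf-t) SP

  module Witness (X : Subset m) (X-leafEdges : ∀ e → e ∈ X → IsLeafEdge T e) (X-even : 2 ∣ ∣ X ∣) where

    root : Fin n
    root = fromℕ< (proj₁ (proj₁ tree))

    -- The walks from a fixed root to the leaves of X, as a multiset of edges. A walk has odd incidence
    -- exactly at its two ends, and the contributions at the root cancel because |X| is even.
    starEdges : List (Fin m)
    starEdges = concatMap (λ f → walkEdges T (connected root (leafEnd T f))) (elements X)

    incidenceParity-starEdges : ∀ v →
      incidenceParity T v starEdges ≡ parity (λ f → does (leafEnd T f ≟ v)) (elements X)
    incidenceParity-starEdges v = begin
      incidenceParity T v starEdges
        ≡⟨ parity-concatMap _ (λ f → walkEdges T (connected root (leafEnd T f))) (elements X) ⟩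
      parity (λ f → incidenceParity T v (walkEdges T (connected root (leafEnd T f)))) (elements X)
        ≡⟨ parity-cong (elements X) (λ {f} _ → incidenceParity-walk T acyclic (connected root (leafEnd T f))) ⟩
      parity (λ f → does (root ≟ v) xor does (leafEnd T f ≟ v)) (elements X)
        ≡⟨ parity-xor (λ _ → does (root ≟ v)) (λ f → does (leafEnd T f ≟ v)) (elements X) ⟩
      parity (λ _ → does (root ≟ v)) (elements X) xor parity (λ f → does (leafEnd T f ≟ v)) (elements X)
        ≡⟨ cong (_xor parity (λ f → does (leafEnd T f ≟ v)) (elements X))
             (parity-const-even (does (root ≟ v)) (elements X) (subst (2 ∣_) (sym (length-elements X)) X-even)) ⟩
      parity (λ f → does (leafEnd T f ≟ v)) (elements X) ∎
      where open ≡-Reasoning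

    support : Fin m → Bool
    support = oddIn starEdges

    support-even : EvenAtInternal T support
    support-even v internal a b c a∼v b∼v c∼v a≢b a≢c b≢c = begin
      support a xor (support b xor support c)
        ≡⟨ oddIn-internal T internal a∼v b∼v c∼v a≢b a≢c b≢c starEdges ⟩
      incidenceParity T v starEdges
        ≡⟨ incidenceParity-starEdges v ⟩
      parity (λ f → does (leafEnd T f ≟ v)) (elements X)
        ≡⟨ parity-false (elements X) (λ f∈ → dec-false (_ ≟ v) λ ℓf≡v → leaf≢internal T
             (subst (IsLeaf T) ℓf≡v (leafEnd-leaf T (X-leafEdges _ (∈-elements⁻ X f∈)))) internal) ⟩
      false ∎
      where open ≡-Reasoning

    support-leafEdge : ∀ {e} → IsLeafEdge T e → support e ≡ lookupᵛ X e
    support-leafEdge {e} leafEdge = begin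
      support e
        ≡⟨ oddIn-leaf T (leafEnd-leaf T leafEdge) (leafEnd-incident T e) starEdges ⟩
      incidenceParity T (leafEnd T e) starEdges
        ≡⟨ incidenceParity-starEdges (leafEnd T e) ⟩
      parity (λ f → does (leafEnd T f ≟ leafEnd T e)) (elements X)
        ≡⟨ parity-cong (elements X) (λ {f} _ → same-leaf f) ⟩
      parity (λ f → does (f ≟ e)) (elements X)
        ≡⟨ parity-elements X e ⟩
      lookupᵛ X e ∎
      where
      open ≡-Reasoning
      same-leaf : ∀ f → does (leafEnd T f ≟ leafEnd T e) ≡ does (f ≟ e)
      same-leaf f with f ≟ e
      ... | yes refl = dec-true (leafEnd T f ≟ leafEnd T f) refl
      ... | no f≢e   = dec-false (leafEnd T f ≟ leafEnd T e) λ ℓf≡ℓe → f≢e (leaf-edge-unique T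
        (leafEnd-leaf T leafEdge) (subst (Incident T f) ℓf≡ℓe (leafEnd-incident T f)) (leafEnd-incident T e))

    support-on-X : ∀ {e} → e ∈ X → support e ≡ true
    support-on-X e∈X = trans (support-leafEdge (X-leafEdges _ e∈X)) ([]=⇒lookup e∈X)

    support-off-X : ∀ {e} → IsLeafEdge T e → e ∉ X → support e ≡ false
    support-off-X leafEdge e∉X = trans (support-leafEdge leafEdge) (∉⇒lookup≡false e∉X)

    agrees-on-leafEdges : ∀ (y : Fin m → ℚ) →
      (∀ e → e ∈ X → y e ≡ ½) → (∀ e → IsLeafEdge T e → e ∉ X → y e ≡ 0ℚ) →
      ∀ e → IsLeafEdge T e → y e ≡ half (support e)
    agrees-on-leafEdges y y-on y-off e leafEdge with e ∈? X
    ... | yes e∈X = trans (y-on e e∈X) (sym (cong half (support-on-X e∈X)))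
    ... | no e∉X  = trans (y-off e leafEdge e∉X) (sym (cong half (support-off-X leafEdge e∉X)))

lemma1 : ∀ {n m : ℕ} (T : Graph n m) → Is13Tree T →
    (X : Subset m) → (∀ e → e ∈ X → IsLeafEdge T e) → 2 ∣ ∣ X ∣ →
    Σ (Fin m → ℚ) λ x →
      (InP T x ×
       (∀ e → e ∈ X → x e ≡ ½) ×
       (∀ e → IsLeafEdge T e → e ∉ X → x e ≡ 0ℚ)) ×
      (∀ y → InP T y →
         (∀ e → e ∈ X → y e ≡ ½) →
         (∀ e → IsLeafEdge T e → e ∉ X → y e ≡ 0ℚ) →
         ∀ e → y e ≡ x e) ×
      (∀ e → x e ≡ 0ℚ ⊎ x e ≡ ½) ×
      SupportIsDisjointLeafPaths T x
lemma1 {n} T tree X X-leafEdges X-even =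
  half ∘ support ,
  (support∈P , (λ e e∈X → cong half (support-on-X e∈X))
             , (λ e leafEdge e∉X → cong half (support-off-X leafEdge e∉X))) ,
  (λ y y∈P y-on y-off →
     InP-determined-by-leafEdges T tree support y support∈P y∈P (agrees-on-leafEdges y y-on y-off)) ,
  (λ e → half-values (support e)) ,
  DisjointLeafPathsCovering-resp T true⇒half≢0 half≢0⇒true
    (decompose T tree (allFin n) support support-even (λ {w} _ _ _ → ∈-allFin w))
  where
  open Witness T tree X X-leafEdges X-even
  support∈P : InP T (half ∘ support)
  support∈P = EvenAtInternal⇒half-InP T support support-even
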